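{- For an assembly $X=(|X|,E_X)$ over $\mathcal S$, define the assembly $L(X)=(|X|\cup\{\bot_X\},E_{L(X)})$, where $\bot_X\notin|X|$, $E_{L(X)}(\bot_X)=\{\emptyset\}$ and $E_{L(X)}(x)=\{[U,\overline 1]\mid U\in E_X(x)\}$ for $x\in|X|$; for a morphism $f\colon X\to Y$ of assemblies let $L(f)$ be the extension of $f$ with $\bot_X\mapsto\bot_Y$; and let $\eta_X\colon X\to L(X)$ be $\eta_X(x)=x$. Then $L$ is a functor ${\sf Ass}(\mathcal S)\to{\sf Ass}(\mathcal S)$, $\eta$ is a natural transformation from the identity to $L$, and $L$ is the lift functor (partial map classifier) for the dominance $\Sigma$ on assemblies: for all assemblies $X,Y$, every $\Sigma$-subobject $m\colon U\to X$ with $U$ an assembly and every morphism $f\colon U\to Y$, there is a unique morphism $\tilde f\colon X\to L(Y)$ such that the square with sides $m$, $f$, $\tilde f$, $\eta_Y$ (i.e. $\tilde f\circ m=\eta_Y\circ f$) is a pullback.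
   Context: $\mathcal S$ is Scott's graph model $\mathcal P(\mathbb N)$ (topologised by basic opens $\{U\mid p\subseteq U\}$, $p$ finite) with application $UV=\{n\mid \exists m\,(e_m\subseteq V\wedge\langle m,n\rangle\in U)\}$ ($e_m$ the finite set with $m=\sum_{k\in e_m}2^k$, $\langle\cdot,\cdot\rangle$ a fixed pairing bijection). $\overline 1=\{1\}$ and $[U,V]$ denotes a standard coding of pairs of elements of $\mathcal S$. ${\sf Ass}(\mathcal S)$ is the category of assemblies $(|X|,E_X)$ ($E_X(x)$ nonempty subsets of $\mathcal S$) with morphisms the functions tracked by some element of $\mathcal S$; it is a full subcategory of the realizability topos ${\sf RT}(\mathcal S)$. The Sierpinski object $\Sigma=(\{0,1\},E_\Sigma)$, $E_\Sigma(0)=\{\emptyset\}$, $E_\Sigma(1)=\{\{1\}\}$, is a dominance in ${\sf RT}(\mathcal S)$ (via $0\mapsto$ false, $1\mapsto$ true into $\Omega$). A mono $U\to X$ is a $\Sigma$-subobject if it is a pullback of $1\xrightarrow{1}\Sigma$ along some morphism $X\to\Sigma$. -}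

module Defs where

open import Level using (Level)
open import Data.Nat using (ℕ; zero; suc; _+_; _*_; _/_; _%_)

open import Data.Product using (Σ; _×_; _,_; proj₁; proj₂)
open import Data.Sum using (_⊎_; inj₁; inj₂)
open import Data.Unit using (⊤; tt)
open import Data.Empty using (⊥; ⊥-elim)
open import Data.Nat.Properties using (*-cancelˡ-≡; even≢odd)
open import Data.Bool using (Bool; true; false)
open import Data.Maybe using (Maybe; just; nothing)
import Data.Maybe as Maybe
open import Function using (_∘_; id)
open import Function.Bundles using (_↔_; Inverse)
open import Relation.Binary.PropositionalEquality using (_≡_; refl; sym; trans; cong; subst)

-- Elements of Scott's graph model S = P(ℕ), as predicates on ℕ.
-- Two elements are equal as subsets iff they are pointwise equivalent.

S : Set₁
S = ℕ → Set

_≐_ : S → S → Set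
U ≐ V = ∀ n → (U n → V n) × (V n → U n)

≐-refl : ∀ {U} → U ≐ U
≐-refl n = id , id

≐-sym : ∀ {U V} → U ≐ V → V ≐ U
≐-sym p n = proj₂ (p n) , proj₁ (p n)

≐-trans : ∀ {U V W} → U ≐ V → V ≐ W → U ≐ W
≐-trans p q n = proj₁ (q n) ∘ proj₁ (p n) , proj₂ (p n) ∘ proj₂ (q n)

∅ : S
∅ _ = ⊥

one : S
one n = n ≡ 1

-- e m : the finite set with m = Σ_{k ∈ e m} 2^k  (k ∈ e m iff bit k of m is 1)
e : ℕ → ℕ → Set
e m zero    = m % 2 ≡ 1
e m (suc k) = e (m / 2) k

_⊆_ : S → S → Set
U ⊆ V = ∀ k → U k → V k

[_,_] : S → S → S
[ U , V ] n = Σ ℕ (λ k → n ≡ 2 * k × U k) ⊎ Σ ℕ (λ k → n ≡ suc (2 * k) × V k)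

module Model (pr : (ℕ × ℕ) ↔ ℕ) where

  ⟨_,_⟩ : ℕ → ℕ → ℕ
  ⟨ m , n ⟩ = Inverse.to pr (m , n)

  app : S → S → S
  app U V n = Σ ℕ (λ m → (e m ⊆ V) × U ⟨ m , n ⟩)

  -- Assemblies over S: E x is a nonempty subset of S (closed under ≐,
  -- i.e. a genuine set of subsets of ℕ).
  record Assembly : Set₁ where
    field
      Car   : Set
      E     : Car → S → Set
      E-ne  : ∀ x → Σ S (E x)
      E-ext : ∀ x {U V} → U ≐ V → E x U → E x V
  open Assembly public

  record Hom (X Y : Assembly) : Set₁ where
    field
      fun     : Car X → Car Y
      tracked : Σ S (λ r → ∀ x U → E X x U → E Y (fun x) (app r U))
  open Hom public

  _≈_ : ∀ {X Y} → Hom X Y → Hom X Y → Set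
  f ≈ g = ∀ x → fun f x ≡ fun g x

  IsMono : ∀ {U X} → Hom U X → Set₁
  IsMono {U} m = ∀ {W} (a b : Hom W U) → (∀ w → fun m (fun a w) ≡ fun m (fun b w)) → a ≈ b

  -- the square  P --p₂--> B
  --             |p₁       |g
  --             A  --f--> C        is a pullback in Ass(S)
  IsPullback : ∀ {A B C P} → Hom A C → Hom B C → Hom P A → Hom P B → Set₁
  IsPullback {A} {B} {C} {P} f g p₁ p₂ =
    (∀ x → fun f (fun p₁ x) ≡ fun g (fun p₂ x)) ×
    (∀ {W : Assembly} (a : Hom W A) (b : Hom W B) →
       (∀ w → fun f (fun a w) ≡ fun g (fun b w)) →
       Σ (Hom W P) (λ u →
         (∀ w → fun p₁ (fun u w) ≡ fun a w) ×
         (∀ w → fun p₂ (fun u w) ≡ fun b w) ×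
         (∀ (u' : Hom W P) → (∀ w → fun p₁ (fun u' w) ≡ fun a w) →
            (∀ w → fun p₂ (fun u' w) ≡ fun b w) → u' ≈ u)))

  𝟙 : Assembly
  𝟙 = record { Car = ⊤ ; E = λ _ _ → ⊤ ; E-ne = λ _ → ∅ , tt ; E-ext = λ _ _ _ → tt }

  ! : ∀ {X} → Hom X 𝟙
  ! = record { fun = λ _ → tt ; tracked = ∅ , λ _ _ _ → tt }

  -- the Sierpinski object Σ = ({0,1}, E), E(0) = {∅}, E(1) = {{1}}  (0 = false, 1 = true)
  EΣ : Bool → S → Set
  EΣ false U = U ≐ ∅
  EΣ true  U = U ≐ one

  ΣA : Assembly
  ΣA = record
    { Car = Bool ; E = EΣ
    ; E-ne = λ { false → ∅ , ≐-refl ; true → one , ≐-refl }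
    ; E-ext = λ { false p q → ≐-trans (≐-sym p) q ; true p q → ≐-trans (≐-sym p) q } }

  private
    e0 : ∀ k → e 0 k → ⊥
    e0 zero ()
    e0 (suc k) p = e0 k p

    inj : ∀ {x y} → ⟨ proj₁ x , proj₂ x ⟩ ≡ ⟨ proj₁ y , proj₂ y ⟩ → x ≡ y
    inj {x} {y} p = trans (sym (Inverse.strictlyInverseʳ pr x))
                     (trans (cong (Inverse.from pr) p) (Inverse.strictlyInverseʳ pr y))

  top : Hom 𝟙 ΣA
  top = record
    { fun = λ _ → true
    ; tracked = (λ n → n ≡ ⟨ 0 , 1 ⟩)
              , λ _ U _ n → (λ { (m , _ , q) → cong proj₂ (inj q) })
                          , (λ { refl → 0 , (λ k p → ⊥-elim (e0 k p)) , refl }) }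

  IsΣSubobject : ∀ {U X} → Hom U X → Set₁
  IsΣSubobject {U} {X} m = IsMono m × Σ (Hom X ΣA) (λ χ → IsPullback χ top m !)

  -- the lift L(X) = (|X| ∪ {⊥_X}, E_L), with ⊥_X = nothing and x ∈ |X| as just x
  evenPart : S → S
  evenPart V k = V (2 * k)

  EL : (X : Assembly) → Maybe (Car X) → S → Set
  EL X nothing  V = V ≐ ∅
  -- V ∈ {[U,1̄] | U ∈ E_X(x)}  iff  V = [U,1̄] for U the even part of V, and U ∈ E_X(x)
  -- (the only possible U is the even part; this keeps E_L small)
  EL X (just x) V = E X x (evenPart V) × (V ≐ [ evenPart V , one ])

  private
    evenPair : ∀ {U V : S} → evenPart [ U , V ] ≐ U
    evenPair {U} k =
      (λ { (inj₁ (j , p , u)) → subst U (sym (*-cancelˡ-≡ k j 2 p)) u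
         ; (inj₂ (j , p , _)) → ⊥-elim (even≢odd k j p) })
      , λ u → inj₁ (k , refl , u)

    pair-cong : ∀ {U U' V} → U ≐ U' → [ U , V ] ≐ [ U' , V ]
    pair-cong p n =
      (λ { (inj₁ (j , q , u)) → inj₁ (j , q , proj₁ (p j) u) ; (inj₂ r) → inj₂ r })
      , (λ { (inj₁ (j , q , u)) → inj₁ (j , q , proj₂ (p j) u) ; (inj₂ r) → inj₂ r })

    even-cong : ∀ {V V'} → V ≐ V' → evenPart V ≐ evenPart V'
    even-cong p k = p (2 * k)

  L : Assembly → Assembly
  L X = record
    { Car = Maybe (Car X) ; E = EL X
    ; E-ne = λ { nothing → ∅ , ≐-refl
               ; (just x) → [ proj₁ (E-ne X x) , one ]
                          , E-ext X x (≐-sym evenPair) (proj₂ (E-ne X x))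
                          , pair-cong (≐-sym evenPair) }
    ; E-ext = λ { nothing p q → ≐-trans (≐-sym p) q
                ; (just x) p (u , q) → E-ext X x (even-cong p) u
                                     , ≐-trans (≐-sym p) (≐-trans q (pair-cong (even-cong p))) } }

  Lfun : ∀ {A B : Set} → (A → B) → Maybe A → Maybe B
  Lfun f = Maybe.map f

  ηfun : ∀ {A : Set} → A → Maybe A
  ηfun = just

module Submission where

-- The classifying property then follows from the pullback defining the
-- Σ-subobject m: m is injective and has a tracked inverse on χ⁻¹(1), and
-- f̃ x = just (f (m⁻¹ x)) when χ x = 1, f̃ x = ⊥ otherwise.

open import Defs
open import Data.Nat using (ℕ)
open import Data.Product using (Σ; _×_)
open import Data.Maybe using (Maybe)
open import Function using (_∘_; id)
open import Function.Bundles using (_↔_)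
open import Relation.Binary.PropositionalEquality using (_≡_)

open import Data.Nat using (zero; suc; _+_; _*_; _/_; _%_; _<_; z≤n; s≤s; _≟_)
open import Data.Nat.Properties
  using (≤-trans; *-monoˡ-≤; m≤m*n; m≤m+n; m≤n+m; n<1+n; m<1+n⇒m<n∨m≡n; *-cancelˡ-≡; even≢odd)
open import Data.Nat.DivMod using (m/n*n≤m; m*n%n≡0; [m+kn]%n≡m%n; m*n/n≡m; +-distrib-/)
open import Data.Product using (_,_; proj₁; proj₂; uncurry)
open import Data.Sum using (_⊎_; inj₁; inj₂; [_,_]′)
open import Data.Bool using (Bool; true; false; T)
open import Data.Unit using (tt)
open import Data.Empty using (⊥-elim)
open import Data.Maybe using (just; nothing)
open import Data.Maybe.Properties using (just-injective; map-id; map-∘)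
open import Function.Bundles using (Inverse)
open import Relation.Nullary using (Dec; yes; no; ¬_)
open import Relation.Nullary.Decidable using (isYes; toWitness; fromWitness; _⊎-dec_)
open import Relation.Binary.PropositionalEquality using (refl; sym; trans; cong; subst)

e? : ∀ m k → Dec (e m k)
e? m zero    = m % 2 ≟ 1
e? m (suc k) = e? (m / 2) k

e-empty : ∀ {V : S} → e 0 ⊆ V
e-empty zero    ()
e-empty {V} (suc k) p = e-empty {V ∘ suc} k p

-- Every element of e_m is below m: if k < m/2 then k+1 < m, as 2(k+1) ≤ 2(m/2) ≤ m.
e-bound : ∀ m k → e m k → k < m
e-bound zero    zero    ()
e-bound (suc m) zero    _ = s≤s z≤n
e-bound m       (suc k) p =
  ≤-trans (s≤s (s≤s (m≤m*n k 2))) (≤-trans (*-monoˡ-≤ 2 (e-bound (m / 2) k p)) (m/n*n≤m m 2))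

cons : Bool → ℕ → ℕ
cons false n = n * 2
cons true  n = suc (n * 2)

cons-low : ∀ b n → e (cons b n) 0 → T b
cons-low false n p with () ← trans (sym (m*n%n≡0 n 2)) p
cons-low true  n _ = tt

low-cons : ∀ b n → T b → e (cons b n) 0
low-cons true n _ = [m+kn]%n≡m%n 1 n 2

cons-high : ∀ b n → cons b n / 2 ≡ n
cons-high false n = m*n/n≡m n 2
cons-high true  n = trans (+-distrib-/ 1 (n * 2) 1+0<2) (m*n/n≡m n 2)
  where
  1+0<2 : 1 % 2 + (n * 2) % 2 < 2
  1+0<2 = subst (λ r → 1 + r < 2) (sym (m*n%n≡0 n 2)) (s≤s (s≤s z≤n))

fromBits : ℕ → (ℕ → Bool) → ℕ
fromBits zero    p = 0
fromBits (suc F) p = cons (p 0) (fromBits F (p ∘ suc))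

fromBits-sound : ∀ F p k → e (fromBits F p) k → T (p k)
fromBits-sound zero    p k       q = ⊥-elim (e-empty k q)
fromBits-sound (suc F) p zero    q = cons-low (p 0) _ q
fromBits-sound (suc F) p (suc k) q =
  fromBits-sound F (p ∘ suc) k (subst (λ n → e n k) (cons-high (p 0) _) q)

fromBits-complete : ∀ F p k → k < F → T (p k) → e (fromBits F p) k
fromBits-complete (suc F) p zero    _         t = low-cons (p 0) _ t
fromBits-complete (suc F) p (suc k) (s≤s k<F) t =
  subst (λ n → e n k) (sym (cons-high (p 0) _)) (fromBits-complete F (p ∘ suc) k k<F t)

record Code (Q : S) : Set where
  field
    num      : ℕ
    sound    : e num ⊆ Q
    complete : Q ⊆ e num
open Code

decidableCode : ∀ {Q : S} F → (∀ k → Dec (Q k)) → (∀ k → Q k → k < F) → Code Q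
decidableCode F Q? bound = record
  { num      = fromBits F (isYes ∘ Q?)
  ; sound    = λ k p → toWitness {a? = Q? k} (fromBits-sound F _ k p)
  ; complete = λ k q → fromBits-complete F _ k (bound k q) (fromWitness {a? = Q? k} q) }

singleton : ∀ j → Code (_≡ j)
singleton j = decidableCode (suc j) (_≟ j) (λ { k refl → n<1+n k })

union : ∀ a b → Code (λ k → e a k ⊎ e b k)
union a b = decidableCode (a + b) (λ k → e? a k ⊎-dec e? b k)
  (λ k → [ (λ p → ≤-trans (e-bound a k p) (m≤m+n a b)) , (λ p → ≤-trans (e-bound b k p) (m≤n+m b a)) ]′)

singleton-⊆ : ∀ {V : S} {j} → V j → e (num (singleton j)) ⊆ V
singleton-⊆ {V} v k p = subst V (sym (sound (singleton _) k p)) v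

union-⊆ : ∀ {V : S} {a b} → e a ⊆ V → e b ⊆ V → e (num (union a b)) ⊆ V
union-⊆ {a = a} {b} sa sb k p = [ sa k , sb k ]′ (sound (union a b) k p)

⊆-unionˡ : ∀ {a b} → e a ⊆ e (num (union a b))
⊆-unionˡ {a} {b} k p = complete (union a b) k (inj₁ p)

⊆-unionʳ : ∀ {a b} → e b ⊆ e (num (union a b))
⊆-unionʳ {a} {b} k p = complete (union a b) k (inj₂ p)

pair-mono : ∀ {U U' V : S} → U ⊆ U' → [ U , V ] ⊆ [ U' , V ]
pair-mono s n (inj₁ (k , q , u)) = inj₁ (k , q , s k u)
pair-mono s n (inj₂ r)           = inj₂ r

pair-cong : ∀ {U U' V : S} → U ≐ U' → [ U , V ] ≐ [ U' , V ]
pair-cong p n = pair-mono (λ k → proj₁ (p k)) n , pair-mono (λ k → proj₂ (p k)) n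

-- 3 = 2·1+1 lies in every [U,1̄]; it witnesses "defined" in L.
three∈pair : ∀ {U : S} → [ U , one ] 3
three∈pair = inj₂ (1 , refl , refl)

module Lift (pr : (ℕ × ℕ) ↔ ℕ) where
  open Model pr

  evenPart-pair : ∀ {U V : S} → evenPart [ U , V ] ≐ U
  evenPart-pair {U} k =
    (λ { (inj₁ (j , p , u)) → subst U (sym (*-cancelˡ-≡ k j 2 p)) u
       ; (inj₂ (j , p , _)) → ⊥-elim (even≢odd k j p) })
    , λ u → inj₁ (k , refl , u)

  -- The graph {⟨m,n⟩ | P m n} of a relation between codes of finite sets and
  -- outputs; applied to V it yields the n with P m n for some e_m ⊆ V.
  graph : (ℕ → ℕ → Set) → S
  graph P j = uncurry P (Inverse.from pr j)

  graph-intro : ∀ P {V : S} {m n} → e m ⊆ V → P m n → app (graph P) V n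
  graph-intro P {m = m} {n} s p =
    m , s , subst (uncurry P) (sym (Inverse.strictlyInverseʳ pr (m , n))) p

  graph-elim : ∀ P {V : S} {n} → app (graph P) V n → Σ ℕ λ m → e m ⊆ V × P m n
  graph-elim P (m , s , p) = m , s , subst (uncurry P) (Inverse.strictlyInverseʳ pr (m , _)) p

  app-mono : ∀ c {A B : S} → A ⊆ B → app c A ⊆ app c B
  app-mono c s n (m , t , q) = m , (λ k x → s k (t k x)) , q

  app-cong : ∀ c {A B : S} → A ≐ B → app c A ≐ app c B
  app-cong c p n = app-mono c (λ k → proj₁ (p k)) n , app-mono c (λ k → proj₂ (p k)) n

  app-compact : ∀ b {V : S} M → e M ⊆ app b V → Σ ℕ λ N → e N ⊆ V × e M ⊆ app b (e N)
  app-compact b {V} M M⊆ =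
    let (N , N⊆ , covers) = collect M in N , N⊆ , λ j x → covers j (e-bound M j x) x
    where
    Covering : ℕ → Set
    Covering F = Σ ℕ λ N → e N ⊆ V × (∀ j → j < F → e M j → app b (e N) j)

    extend : ∀ F → Covering F → Dec (e M F) → Covering (suc F)
    extend F (N , N⊆ , covers) (no F∉) = N , N⊆ , λ j j<1+F x →
      [ (λ j<F → covers j j<F x) , (λ { refl → ⊥-elim (F∉ x) }) ]′ (m<1+n⇒m<n∨m≡n j<1+F)
    extend F (N , N⊆ , covers) (yes F∈) with M⊆ F F∈
    ... | mF , mF⊆ , bF = num (union N mF) , union-⊆ N⊆ mF⊆ , λ j j<1+F x →
      [ (λ j<F → app-mono b ⊆-unionˡ j (covers j j<F x))
      , (λ { refl → mF , ⊆-unionʳ {N} , bF }) ]′ (m<1+n⇒m<n∨m≡n j<1+F)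

    collect : ∀ F → Covering F
    collect zero    = 0 , e-empty , λ _ ()
    collect (suc F) = extend F (collect F) (e? M F)

  reindexR : (ℕ → ℕ) → S
  reindexR ρ = graph λ m n → e m (ρ n)

  reindexR-spec : ∀ ρ V → app (reindexR ρ) V ≐ (V ∘ ρ)
  reindexR-spec ρ V n =
    (λ q → let (m , s , x) = graph-elim (λ m n → e m (ρ n)) q in s (ρ n) x)
    , λ v → graph-intro (λ m n → e m (ρ n)) (singleton-⊆ v) (complete (singleton (ρ n)) _ refl)

  constR : S → S
  constR W = graph λ _ n → W n

  constR-spec : ∀ W V → app (constR W) V ≐ W
  constR-spec W V n =
    (λ q → proj₂ (proj₂ (graph-elim (λ _ n → W n) q))) , graph-intro (λ _ n → W n) e-empty

  compR : S → S → S
  compR a b = graph λ m n → app a (app b (e m)) n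

  compR-spec : ∀ a b V → app (compR a b) V ≐ app a (app b V)
  compR-spec a b V n =
    (λ q → let (m , s , x) = graph-elim P q in app-mono a (app-mono b s) n x)
    , λ { (M , M⊆ , an) → let (N , N⊆ , covers) = app-compact b M M⊆ in
                          graph-intro P N⊆ (M , covers , an) }
    where
    P : ℕ → ℕ → Set
    P m n = app a (app b (e m)) n

  probe : ℕ → S
  probe k = graph λ m n → e m k × one n

  probe-spec : ∀ k V → app (probe k) V ≐ (λ n → V k × one n)
  probe-spec k V n =
    (λ q → let (m , s , x , o) = graph-elim P q in s k x , o)
    , λ { (v , o) → graph-intro P (singleton-⊆ v) (complete (singleton k) k refl , o) }
    where
    P : ℕ → ℕ → Set
    P m n = e m k × one n

  guard : S → S → S
  guard c g = graph λ m n → app c (e m) 1 × [ app g (e m) , one ] n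

  guard-off : ∀ c g {V} → ¬ app c V 1 → app (guard c g) V ≐ ∅
  guard-off c g off n =
    (λ q → let (m , s , c1 , _) = graph-elim P q in off (app-mono c s 1 c1)) , λ ()
    where
    P : ℕ → ℕ → Set
    P m n = app c (e m) 1 × [ app g (e m) , one ] n

  guard-on : ∀ c g {V} → app c V 1 → app (guard c g) V ≐ [ app g V , one ]
  guard-on c g {V} (m₁ , s₁ , c₁) n =
    (λ q → let (m , s , _ , r) = graph-elim P q in pair-mono (app-mono g s) n r)
    , λ { (inj₁ (k , eq , (m₂ , s₂ , gk))) →
            graph-intro P (union-⊆ s₁ s₂)
              ((m₁ , ⊆-unionˡ {b = m₂} , c₁) , inj₁ (k , eq , (m₂ , ⊆-unionʳ {m₁} , gk)))
        ; (inj₂ r) → graph-intro P s₁ ((m₁ , (λ _ x → x) , c₁) , inj₂ r) }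
    where
    P : ℕ → ℕ → Set
    P m n = app c (e m) 1 × [ app g (e m) , one ] n

  EL-just : ∀ Y {y R W} → E Y y R → W ≐ [ R , one ] → EL Y (just y) W
  EL-just Y {y} {R} {W} r p = E-ext Y y R≐ r , ≐-trans p (pair-cong R≐)
    where
    R≐ : R ≐ evenPart W
    R≐ = ≐-trans (≐-sym evenPart-pair) (λ k → ≐-sym p (2 * k))

  Guarded : (Y : Assembly) → S → S → Maybe (Car Y) → S → Set
  Guarded Y c g nothing  V = ¬ app c V 1
  Guarded Y c g (just y) V = app c V 1 × E Y y (app g V)

  intoL : ∀ {X Y} (φ : Car X → Maybe (Car Y)) c g →
          (∀ x V → E X x V → Guarded Y c g (φ x) V) → Hom X (L Y)
  intoL {X} {Y} φ c g guarded = record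
    { fun = φ ; tracked = guard c g , λ x V v → realizes (φ x) (guarded x V v) }
    where
    realizes : ∀ {V} z → Guarded Y c g z V → EL Y z (app (guard c g) V)
    realizes nothing  off      = guard-off c g off
    realizes (just y) (on , r) = EL-just Y r (guard-on c g on)

  -- L(f): definedness is tested by 3, the value by f's realizer on the even part.
  Lmor : ∀ {X Y} (f : Hom X Y) → Hom (L X) (L Y)
  Lmor {X} {Y} f = intoL (Lfun (fun f)) (probe 3) (compR r (reindexR (2 *_))) guarded
    where
    r : S
    r = proj₁ (tracked f)
    guarded : ∀ z V → EL X z V → Guarded Y (probe 3) (compR r (reindexR (2 *_))) (Lfun (fun f) z) V
    guarded nothing  V V≐∅ p = proj₁ (V≐∅ 3) (proj₁ (proj₁ (probe-spec 3 V 1) p))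
    guarded (just x) V (u , V≐) =
      proj₂ (probe-spec 3 V 1) (proj₂ (V≐ 3) three∈pair , refl)
      , E-ext Y (fun f x) (≐-sym value≐) (proj₂ (tracked f) x _ u)
      where
      value≐ : app (compR r (reindexR (2 *_))) V ≐ app r (evenPart V)
      value≐ = ≐-trans (compR-spec r (reindexR (2 *_)) V) (app-cong r (reindexR-spec (2 *_) V))

  ηmor : ∀ X → Hom X (L X)
  ηmor X = intoL just (constR one) (reindexR id) λ x V v →
    proj₂ (constR-spec one V 1) refl , E-ext X x (≐-sym (reindexR-spec id V)) v

  constMor : ∀ {W Z : Assembly} → Car Z → Hom W Z
  constMor {Z = Z} z = record
    { fun = λ _ → z
    ; tracked = constR (proj₁ (E-ne Z z))
              , λ _ V _ → E-ext Z z (≐-sym (constR-spec _ V)) (proj₂ (E-ne Z z)) }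

  compMor : ∀ {X Y Z} → Hom Y Z → Hom X Y → Hom X Z
  compMor {Z = Z} g f = record
    { fun = fun g ∘ fun f
    ; tracked = compR (proj₁ (tracked g)) (proj₁ (tracked f))
              , λ x V v → E-ext Z _ (≐-sym (compR-spec (proj₁ (tracked g)) (proj₁ (tracked f)) V))
                            (proj₂ (tracked g) _ _ (proj₂ (tracked f) x V v)) }

  -- Monomorphisms of assemblies are injective (test against maps out of 𝟙).
  mono-injective : ∀ {U X} {m : Hom U X} → IsMono m → ∀ {a b} → fun m a ≡ fun m b → a ≡ b
  mono-injective mono {a} {b} eq = mono {𝟙} (constMor a) (constMor b) (λ _ → eq) tt

  module Classifier {X Y U : Assembly} (m : Hom U X) (sub : IsΣSubobject m) (f : Hom U Y)
                    (ηY : Hom Y (L Y)) (ηY-just : ∀ y → fun ηY y ≡ ηfun y) where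
    χ : Hom X ΣA
    χ = proj₁ (proj₂ sub)

    m-injective : ∀ {a b} → fun m a ≡ fun m b → a ≡ b
    m-injective = mono-injective {m = m} (proj₁ sub)

    χm≡true : ∀ u → fun χ (fun m u) ≡ true
    χm≡true = proj₁ (proj₂ (proj₂ sub))

    Truth : Assembly
    Truth = record { Car = Σ (Car X) (λ x → fun χ x ≡ true) ; E = E X ∘ proj₁
                   ; E-ne = E-ne X ∘ proj₁ ; E-ext = E-ext X ∘ proj₁ }

    inclusion : Hom Truth X
    inclusion = record { fun = proj₁
                       ; tracked = reindexR id , λ w V v → E-ext X _ (≐-sym (reindexR-spec id V)) v }

    -- m⁻¹ on χ⁻¹(1), a morphism by the universal property of the pullback
    m⁻¹ : Hom Truth U
    m⁻¹ = proj₁ (proj₂ (proj₂ (proj₂ sub)) inclusion ! proj₂)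

    m∘m⁻¹ : ∀ w → fun m (fun m⁻¹ w) ≡ proj₁ w
    m∘m⁻¹ = proj₁ (proj₂ (proj₂ (proj₂ (proj₂ sub)) inclusion ! proj₂))

    m⁻¹∘m : ∀ u (q : fun χ (fun m u) ≡ true) → fun m⁻¹ (fun m u , q) ≡ u
    m⁻¹∘m u q = m-injective (m∘m⁻¹ (fun m u , q))

    f̃-by : (x : Car X) (b : Bool) → fun χ x ≡ b → Maybe (Car Y)
    f̃-by x false _ = nothing
    f̃-by x true  q = just (fun f (fun m⁻¹ (x , q)))

    f̃fun : Car X → Maybe (Car Y)
    f̃fun x = f̃-by x (fun χ x) refl

    f̃-at : ∀ x {b} (q : fun χ x ≡ b) → f̃fun x ≡ f̃-by x b q
    f̃-at x refl = refl

    f̃-defined : ∀ x {y} → f̃fun x ≡ just y → fun χ x ≡ true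
    f̃-defined x = defined (fun χ x) refl
      where
      defined : ∀ b (q : fun χ x ≡ b) {y} → f̃-by x b q ≡ just y → fun χ x ≡ true
      defined true q _ = q

    -- f̃ is tracked by the guard testing χ's realizer, with value f ∘ m⁻¹
    f̃ : Hom X (L Y)
    f̃ = intoL f̃fun c g λ x V v → guarded x V v (fun χ x) refl
      where
      c : S
      c = proj₁ (tracked χ)
      g : S
      g = proj₁ (tracked (compMor f m⁻¹))
      guarded : ∀ x V → E X x V → ∀ b (q : fun χ x ≡ b) → Guarded Y c g (f̃-by x b q) V
      guarded x V v b q with subst (λ b → EΣ b (app c V)) q (proj₂ (tracked χ) x V v)
      guarded x V v false q | c∅ = proj₁ (c∅ 1)
      guarded x V v true  q | c1 = proj₂ (c1 1) refl , proj₂ (tracked (compMor f m⁻¹)) (x , q) V v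

    square : ∀ u → f̃fun (fun m u) ≡ fun ηY (fun f u)
    square u = trans (f̃-at (fun m u) (χm≡true u))
                     (trans (cong (just ∘ fun f) (m⁻¹∘m u _)) (sym (ηY-just (fun f u))))

    -- a cone (a, b) over (f̃, η_Y) factors uniquely through U via the Σ-pullback
    universal : ∀ {W : Assembly} (a : Hom W X) (b : Hom W Y) →
       (∀ w → f̃fun (fun a w) ≡ fun ηY (fun b w)) →
       Σ (Hom W U) (λ u →
         (∀ w → fun m (fun u w) ≡ fun a w) ×
         (∀ w → fun f (fun u w) ≡ fun b w) ×
         (∀ (u' : Hom W U) → (∀ w → fun m (fun u' w) ≡ fun a w) →
            (∀ w → fun f (fun u' w) ≡ fun b w) → u' ≈ u))
    universal {W} a b cone = u , m∘u , f∘u , λ u' m∘u' _ w → m-injective (trans (m∘u' w) (sym (m∘u w)))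
      where
      a≡just : ∀ w → f̃fun (fun a w) ≡ just (fun b w)
      a≡just w = trans (cone w) (ηY-just (fun b w))
      χa≡true : ∀ w → fun χ (fun a w) ≡ true
      χa≡true w = f̃-defined (fun a w) (a≡just w)
      factor = proj₂ (proj₂ (proj₂ sub)) a ! χa≡true
      u : Hom W U
      u = proj₁ factor
      m∘u : ∀ w → fun m (fun u w) ≡ fun a w
      m∘u = proj₁ (proj₂ factor)
      f∘u : ∀ w → fun f (fun u w) ≡ fun b w
      f∘u w = trans (cong (fun f) (m-injective (trans (m∘u w) (sym (m∘m⁻¹ (fun a w , χa≡true w))))))
                    (just-injective (trans (sym (f̃-at (fun a w) (χa≡true w))) (a≡just w)))

    -- any g making the square a pullback agrees with f̃: on χ⁻¹(1) by the
    -- square, and elsewhere since a defined value g x would put x in the image of m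
    unique : ∀ (g : Hom X (L Y)) → IsPullback g ηY m f → g ≈ f̃
    unique g (g-square , g-universal) x = trans (by-χ (fun χ x) refl) (sym (f̃-at x refl))
      where
      defined⇒true : ∀ {y} → fun g x ≡ just y → fun χ x ≡ true
      defined⇒true {y} gx =
        trans (cong (fun χ) (sym (proj₁ (proj₂ point) tt))) (χm≡true (fun (proj₁ point) tt))
        where
        point = g-universal {𝟙} (constMor x) (constMor y) (λ _ → trans gx (sym (ηY-just y)))

      by-χ : ∀ b (q : fun χ x ≡ b) → fun g x ≡ f̃-by x b q
      by-χ true q = trans (sym (cong (fun g) (m∘m⁻¹ (x , q))))
                          (trans (g-square (fun m⁻¹ (x , q))) (ηY-just _))
      by-χ false q with fun g x in gx
      ... | nothing = refl
      ... | just y with () ← trans (sym (defined⇒true gx)) q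

proposition5p7 : (pr : (ℕ × ℕ) ↔ ℕ) → let open Model pr in
    ((∀ {X Y : Assembly} (f : Hom X Y) →
    Σ (Hom (L X) (L Y)) (λ Lf → ∀ z → fun Lf z ≡ Lfun (fun f) z))
    × (∀ {A : Set} (z : Maybe A) → Lfun (id {A = A}) z ≡ z)
    × (∀ {A B C : Set} (f : A → B) (g : B → C) (z : Maybe A) →
    Lfun (g ∘ f) z ≡ Lfun g (Lfun f z)))
    × ((∀ (X : Assembly) → Σ (Hom X (L X)) (λ η → ∀ x → fun η x ≡ ηfun x))
    × (∀ {A B : Set} (f : A → B) (x : A) → Lfun f (ηfun x) ≡ ηfun (f x)))
    × (∀ {X Y U : Assembly} (m : Hom U X) → IsΣSubobject m → (f : Hom U Y) →
    (ηY : Hom Y (L Y)) → (∀ y → fun ηY y ≡ ηfun y) →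
    Σ (Hom X (L Y)) (λ f~ →
    IsPullback f~ ηY m f
    × (∀ (g : Hom X (L Y)) → IsPullback g ηY m f → g ≈ f~)))
proposition5p7 pr =
  ((λ f → Lmor f , λ _ → refl) , map-id , (λ f g → map-∘))
  , ((λ X → ηmor X , λ _ → refl) , (λ f x → refl))
  , λ m sub f ηY ηY-just → let open Classifier m sub f ηY ηY-just in
                           f̃ , (square , universal) , unique
  where open Lift pr
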